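{- Let $T$ be a tiling of the $n$-gon $P$ and $\sigma=\mathrm{Scott}(T)$. Then (a) $\sigma$ has no fixed points, and (b) there is no $i$ with $\sigma(i)=i+1$.
   Context: Let $P$ be a convex polygon with vertices labelled $1,\dots,n$ ($n\ge3$) in clockwise order, labels modulo $n$. A tiling $T$ is a (possibly empty) set of pairwise non-crossing (in their interiors) diagonals; tiles are the closures of the components of $P$ minus the diagonals. Scott map: for each tile $Q$ with vertices $q_1,\dots,q_r$ in clockwise order (indices mod $r$) and each $j$, draw inside $Q$ a strand segment parallel to $[q_{j-1},q_j]$, entering $Q$ through the side $[q_j,q_{j+1}]$ near $q_j$ and leaving $Q$ through the side $[q_{j-2},q_{j-1}]$ near $q_{j-1}$; if the entering side is a boundary edge of $P$ the segment starts at vertex $q_j$, and if the leaving side is a boundary edge it ends at vertex $q_{j-1}$. At a diagonal shared by two tiles, a segment leaving one tile near an endpoint $v$ is continued by the segment of the other tile entering near $v$. Concatenation gives strands $x\leadsto y$ from a vertex $x$ to a vertex $y$; each vertex starts and ends exactly one strand, and $\mathrm{Scott}(T)$ is the permutation $x\mapsto y$. -}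

module Defs where

open import Data.Nat using (ℕ; zero; suc; _+_; _∸_; _≤_; _<_; NonZero)
open import Data.Nat.DivMod using (_%_; m%n<n)
open import Data.Fin using (Fin; toℕ; fromℕ<)
open import Data.Product using (_×_; _,_)
open import Data.Sum using (_⊎_)
open import Data.List using (List)
open import Data.List.Relation.Unary.All using (All)
open import Data.List.Membership.Propositional using (_∈_)
open import Relation.Nullary using (¬_)
open import Relation.Binary.PropositionalEquality using (_≡_; _≢_)

-- Vertices of the n-gon are Fin n (label k+1 of the paper is `k`);
-- clockwise order is increasing label modulo n.

module _ {n : ℕ} .{{_ : NonZero n}} where

  next : Fin n → Fin n
  next i = fromℕ< (m%n<n (suc (toℕ i)) n)

  dist : Fin n → Fin n → ℕ
  dist a b = (n + toℕ b ∸ toℕ a) % n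

  InArc : Fin n → Fin n → Fin n → Set
  InArc a b v = (0 < dist a v) × (dist a v < dist a b)

  IsDiagonal : Fin n × Fin n → Set
  IsDiagonal (a , b) = (2 ≤ dist a b) × (2 ≤ dist b a)

  Cross : Fin n × Fin n → Fin n × Fin n → Set
  Cross (a , b) (c , d) =
    (a ≢ c) × (a ≢ d) × (b ≢ c) × (b ≢ d) ×
    ((InArc a b c × ¬ InArc a b d) ⊎ (¬ InArc a b c × InArc a b d))

-- A tiling: a finite set (list) of pairwise non-crossing diagonals
-- (a diagonal {a,b} may be listed as (a , b) or (b , a)).
record Tiling (n : ℕ) .{{_ : NonZero n}} : Set where
  field
    diags    : List (Fin n × Fin n)
    areDiags : All IsDiagonal diags
    noCross  : ∀ d e → d ∈ diags → e ∈ diags → ¬ Cross d e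
open Tiling public

module _ {n : ℕ} .{{_ : NonZero n}} (T : Tiling n) where

  Adj : Fin n → Fin n → Set
  Adj a q = (q ≡ next a) ⊎ (a ≡ next q) ⊎ ((a , q) ∈ diags T) ⊎ ((q , a) ∈ diags T)

  -- Directed side (a , b): a side of a tile Q with b the clockwise successor
  -- of a in Q (Q lies on the clockwise arc from b to a).  Prev a b p means
  -- p is the clockwise predecessor of a in that tile Q: the first vertex
  -- joined to a by a side met when going clockwise from b (exclusive).
  Prev : Fin n → Fin n → Fin n → Set
  Prev a b p = Adj a p × InArc b a p ×
               (∀ q → Adj a q → InArc b a q → dist b p ≤ dist b q)

  -- Reach a b y : the strand entering the tile Q through its side (a , b)
  -- near a (Q = tile with clockwise consecutive vertices a , b) ends at y.
  -- In Q it runs from near a (= q_j) to near p (= q_{j-1}), leaving through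
  -- the side (p' , p) (= [q_{j-2}, q_{j-1}]); if that is a boundary edge
  -- the strand ends at p, otherwise it enters the neighbouring tile through
  -- the directed side (p , p') near p.
  data Reach : Fin n → Fin n → Fin n → Set where
    stop : ∀ {a b p p'} → Prev a b p → Prev p a p' → p ≡ next p' → Reach a b p
    cont : ∀ {a b p p' y} → Prev a b p → Prev p a p' → p ≢ next p' →
           Reach p p' y → Reach a b y

  -- Scott(T)(x) = y: the strand starting at vertex x (entering the tile
  -- containing the boundary edge [x, x+1] through that edge) ends at y.
  Scott : Fin n → Fin n → Set
  Scott x y = Reach x (next x) y

module Submission where

open import Defs
open import Data.Nat using (ℕ; _+_; _∸_; _≤_; _<_; NonZero; z≤n; s≤s; _<?_)
open import Data.Nat.Properties
open import Data.Nat.DivMod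
open import Data.Fin using (Fin; toℕ)
open import Data.Fin.Properties using (toℕ-injective; toℕ-fromℕ<; toℕ<n)
open import Data.Product using (_×_; _,_; proj₁; proj₂)
open import Data.Sum using (_⊎_; inj₁; inj₂)
open import Data.Empty using (⊥)
open import Data.List.Membership.Propositional using (_∈_)
open import Function using (_∘_)
open import Relation.Nullary using (¬_; yes; no; contradiction)
open import Relation.Binary.PropositionalEquality
open import Algebra.Properties.CommutativeSemigroup +-commutativeSemigroup using (xy∙z≈xz∙y)

-- A strand entering a tile through the directed side (a , b) ends strictly
-- inside the clockwise arc from b to a.  Inside the tile it runs to the
-- clockwise predecessor p of a and leaves through a side (p , p'); as sides of
-- a tiling never interleave, p' does not lie strictly between a and b, so the
-- arc from p' to p, which by induction contains the end point, is contained in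
-- the arc from b to a.
-- The strand of x enters through the boundary edge (x , x + 1), and the arc
-- from x + 1 to x contains neither x nor x + 1.

[m%d+n]%d≡[m+n]%d : ∀ m n d .{{_ : NonZero d}} → (m % d + n) % d ≡ (m + n) % d
[m%d+n]%d≡[m+n]%d m n d = begin
  (m % d + n) % d          ≡⟨ %-distribˡ-+ (m % d) n d ⟩
  (m % d % d + n % d) % d  ≡⟨ cong (λ k → (k + n % d) % d) (m%n%n≡m%n m d) ⟩
  (m % d + n % d) % d      ≡⟨ %-distribˡ-+ m n d ⟨
  (m + n) % d              ∎
  where open ≡-Reasoning

m<n+n⇒m≡m%n⊎m≡m%n+n : ∀ {m} n .{{_ : NonZero n}} → m < n + n → m ≡ m % n ⊎ m ≡ m % n + n
m<n+n⇒m≡m%n⊎m≡m%n+n {m} n m<n+n with m <? n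
... | yes m<n = inj₁ (sym (m<n⇒m%n≡m m<n))
... | no m≮n = inj₂ (begin
  m                ≡⟨ m∸n+n≡m n≤m ⟨
  m ∸ n + n        ≡⟨ cong (_+ n) (m<n⇒m%n≡m m∸n<n) ⟨
  (m ∸ n) % n + n  ≡⟨ cong (_+ n) (m≤n⇒[n∸m]%m≡n%m n≤m) ⟩
  m % n + n        ∎)
  where
  open ≡-Reasoning
  n≤m : n ≤ m
  n≤m = ≮⇒≥ m≮n
  m∸n<n : m ∸ n < n
  m∸n<n = +-cancelʳ-< n (m ∸ n) n (subst (_< n + n) (sym (m∸n+n≡m n≤m)) m<n+n)

m+n≡o⇒m<o⇒0<n : ∀ {m n o} → m + n ≡ o → m < o → 0 < n
m+n≡o⇒m<o⇒0<n {m} {n} m+n≡o m<o =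
  +-cancelˡ-< m 0 n (subst₂ _<_ (sym (+-identityʳ m)) (sym m+n≡o) m<o)

module _ {n : ℕ} .{{_ : NonZero n}} where

  dist<n : (a v : Fin n) → dist a v < n
  dist<n a v = m%n<n _ n

  dist≡[v+[n∸a]]%n : (a v : Fin n) → dist a v ≡ (toℕ v + (n ∸ toℕ a)) % n
  dist≡[v+[n∸a]]%n a v =
    cong (_% n) (trans (+-∸-comm (toℕ v) (<⇒≤ (toℕ<n a))) (+-comm (n ∸ toℕ a) (toℕ v)))

  dist-spec : (a v : Fin n) → (dist a v + toℕ a) % n ≡ toℕ v
  dist-spec a v = begin
    (dist a v + A) % n           ≡⟨ cong (λ d → (d + A) % n) (dist≡[v+[n∸a]]%n a v) ⟩
    ((V + (n ∸ A)) % n + A) % n  ≡⟨ [m%d+n]%d≡[m+n]%d (V + (n ∸ A)) A n ⟩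
    (V + (n ∸ A) + A) % n        ≡⟨ cong (_% n) (+-assoc V (n ∸ A) A) ⟩
    (V + (n ∸ A + A)) % n        ≡⟨ cong (λ k → (V + k) % n) (m∸n+n≡m (<⇒≤ (toℕ<n a))) ⟩
    (V + n) % n                  ≡⟨ [m+n]%n≡m%n V n ⟩
    V % n                        ≡⟨ m<n⇒m%n≡m (toℕ<n v) ⟩
    V                            ∎
    where
    open ≡-Reasoning
    A = toℕ a
    V = toℕ v

  dist-unique : ∀ {d} (a v : Fin n) → d < n → (d + toℕ a) % n ≡ toℕ v → dist a v ≡ d
  dist-unique {d} a v d<n d+a≡v = begin
    dist a v                     ≡⟨ dist≡[v+[n∸a]]%n a v ⟩
    (V + (n ∸ A)) % n            ≡⟨ cong (λ k → (k + (n ∸ A)) % n) d+a≡v ⟨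
    ((d + A) % n + (n ∸ A)) % n  ≡⟨ [m%d+n]%d≡[m+n]%d (d + A) (n ∸ A) n ⟩
    (d + A + (n ∸ A)) % n        ≡⟨ cong (_% n) (+-assoc d A (n ∸ A)) ⟩
    (d + (A + (n ∸ A))) % n      ≡⟨ cong (λ k → (d + k) % n) (m+[n∸m]≡n (<⇒≤ (toℕ<n a))) ⟩
    (d + n) % n                  ≡⟨ [m+n]%n≡m%n d n ⟩
    d % n                        ≡⟨ m<n⇒m%n≡m d<n ⟩
    d                            ∎
    where
    open ≡-Reasoning
    A = toℕ a
    V = toℕ v

  dist-self : (a : Fin n) → dist a a ≡ 0
  dist-self a = trans (cong (_% n) (m+n∸n≡m n (toℕ a))) (n%n≡0 n)

  dist≡0⇒≡ : (a v : Fin n) → dist a v ≡ 0 → v ≡ a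
  dist≡0⇒≡ a v dist≡0 = toℕ-injective (begin
    toℕ v                   ≡⟨ dist-spec a v ⟨
    (dist a v + toℕ a) % n  ≡⟨ cong (λ d → (d + toℕ a) % n) dist≡0 ⟩
    toℕ a % n               ≡⟨ m<n⇒m%n≡m (toℕ<n a) ⟩
    toℕ a                   ∎)
    where open ≡-Reasoning

  dist-pos : (a v : Fin n) → v ≢ a → 0 < dist a v
  dist-pos a v v≢a = n≢0⇒n>0 (v≢a ∘ dist≡0⇒≡ a v)

  dist-next : (a : Fin n) → dist a (next a) ≡ 1 % n
  dist-next a = dist-unique a (next a) (m%n<n 1 n)
    (trans ([m%d+n]%d≡[m+n]%d 1 (toℕ a) n) (sym (toℕ-fromℕ< _)))

  dist-triangle : (a b v : Fin n) →
    dist a b + dist b v ≡ dist a v ⊎ dist a b + dist b v ≡ dist a v + n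
  dist-triangle a b v =
    subst (λ d → x + y ≡ d ⊎ x + y ≡ d + n)
          (sym (dist-unique a v (m%n<n (x + y) n) sum+a≡v))
          (m<n+n⇒m≡m%n⊎m≡m%n+n n (+-mono-< (dist<n a b) (dist<n b v)))
    where
    open ≡-Reasoning
    x = dist a b
    y = dist b v
    sum+a≡v : ((x + y) % n + toℕ a) % n ≡ toℕ v
    sum+a≡v = begin
      ((x + y) % n + toℕ a) % n  ≡⟨ [m%d+n]%d≡[m+n]%d (x + y) (toℕ a) n ⟩
      (x + y + toℕ a) % n        ≡⟨ cong (_% n) (xy∙z≈xz∙y x y (toℕ a)) ⟩
      (x + toℕ a + y) % n        ≡⟨ [m%d+n]%d≡[m+n]%d (x + toℕ a) y n ⟨
      ((x + toℕ a) % n + y) % n  ≡⟨ cong (λ k → (k + y) % n) (dist-spec a b) ⟩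
      (toℕ b + y) % n            ≡⟨ cong (_% n) (+-comm (toℕ b) y) ⟩
      (y + toℕ b) % n            ≡⟨ dist-spec b v ⟩
      toℕ v                      ∎

  dist-triangle-< : (a b v : Fin n) → dist a b + dist b v < n → dist a b + dist b v ≡ dist a v
  dist-triangle-< a b v sum<n with dist-triangle a b v
  ... | inj₁ sum≡ = sum≡
  ... | inj₂ sum≡ = contradiction (subst (_< n) sum≡ sum<n) (m+n≮n (dist a v) n)

  dist-additive : (a b v : Fin n) → dist a b ≤ dist a v → dist a b + dist b v ≡ dist a v
  dist-additive a b v b≤v with dist-triangle a b v
  ... | inj₁ sum≡ = sum≡
  ... | inj₂ sum≡ = contradiction sum≡ (<⇒≢ (+-mono-≤-< b≤v (dist<n b v)))

  dist+dist-flip≡n : (a b : Fin n) → 0 < dist a b → dist a b + dist b a ≡ n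
  dist+dist-flip≡n a b ab>0 with dist-triangle a b a
  ... | inj₁ sum≡ = contradiction (m+n≡0⇒m≡0 _ (trans sum≡ (dist-self a))) (≢-sym (<⇒≢ ab>0))
  ... | inj₂ sum≡ = trans sum≡ (cong (_+ n) (dist-self a))

  inArc⇒≢start : (a b v : Fin n) → InArc a b v → v ≢ a
  inArc⇒≢start a b v (av>0 , _) v≡a = <⇒≢ av>0 (sym (trans (cong (dist a) v≡a) (dist-self a)))

  inArc⇒≢end : (a b v : Fin n) → InArc a b v → v ≢ b
  inArc⇒≢end a b v (_ , av<ab) v≡b = <-irrefl (cong (dist a) v≡b) av<ab

  ¬inArc-next : (a v : Fin n) → ¬ InArc a (next a) v
  ¬inArc-next a v (av>0 , av<1%n) =
    <⇒≱ (<-≤-trans av<1%n (subst (_≤ 1) (sym (dist-next a)) (m%n≤m 1 n))) av>0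

  inArc-to-base⇒dist< : (a b v : Fin n) → 0 < dist a b → InArc b a v → dist a b < dist a v
  inArc-to-base⇒dist< a b v ab>0 (bv>0 , bv<ba) =
    subst (dist a b <_) sum≡av (m<m+n (dist a b) bv>0)
    where
    sum≡av : dist a b + dist b v ≡ dist a v
    sum≡av = dist-triangle-< a b v
      (subst (dist a b + dist b v <_) (dist+dist-flip≡n a b ab>0) (+-monoʳ-< (dist a b) bv<ba))

  dist<⇒inArc-to-base : (a b v : Fin n) → 0 < dist a b → dist a b < dist a v → InArc b a v
  dist<⇒inArc-to-base a b v ab>0 ab<av =
      m+n≡o⇒m<o⇒0<n sum≡av ab<av
    , +-cancelˡ-< (dist a b) (dist b v) (dist b a)
        (subst₂ _<_ (sym sum≡av) (sym (dist+dist-flip≡n a b ab>0)) (dist<n a v))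
    where
    sum≡av : dist a b + dist b v ≡ dist a v
    sum≡av = dist-additive a b v (<⇒≤ ab<av)

  inArc⇒between : (a c d v : Fin n) → dist a c ≤ dist a d → InArc c d v →
                  dist a c < dist a v × dist a v < dist a d
  inArc⇒between a c d v ac≤ad (cv>0 , cv<cd) =
    subst (dist a c <_) ac+cv≡av (m<m+n (dist a c) cv>0) , subst₂ _<_ ac+cv≡av ac+cd≡ad ac+cv<ac+cd
    where
    ac+cd≡ad : dist a c + dist c d ≡ dist a d
    ac+cd≡ad = dist-additive a c d ac≤ad
    ac+cv<ac+cd : dist a c + dist c v < dist a c + dist c d
    ac+cv<ac+cd = +-monoʳ-< (dist a c) cv<cd
    ac+cv≡av : dist a c + dist c v ≡ dist a v
    ac+cv≡av = dist-triangle-< a c v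
      (<-trans ac+cv<ac+cd (subst (_< n) (sym ac+cd≡ad) (dist<n a d)))

  between⇒inArc : (a c d v : Fin n) → dist a c < dist a v → dist a v < dist a d → InArc c d v
  between⇒inArc a c d v ac<av av<ad =
    m+n≡o⇒m<o⇒0<n ac+cv≡av ac<av , +-cancelˡ-< (dist a c) (dist c v) (dist c d)
      (subst₂ _<_ (sym ac+cv≡av) (sym ac+cd≡ad) av<ad)
    where
    ac+cv≡av : dist a c + dist c v ≡ dist a v
    ac+cv≡av = dist-additive a c v (<⇒≤ ac<av)
    ac+cd≡ad : dist a c + dist c d ≡ dist a d
    ac+cd≡ad = dist-additive a c d (<⇒≤ (<-trans ac<av av<ad))

  inArc-disjoint : (a b v : Fin n) → InArc a b v → ¬ InArc b a v
  inArc-disjoint a b v (av>0 , av<ab) v∈ba =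
    <-asym av<ab (inArc-to-base⇒dist< a b v (<-trans av>0 av<ab) v∈ba)

  -- c lies on the arc a → b and d on the arc b → a, so the cyclic order is a c b d.
  interleaved-rotate : (a b c d : Fin n) → InArc a b c → InArc b a d → InArc c d b
  interleaved-rotate a b c d (ac>0 , ac<ab) d∈ba =
    between⇒inArc a c d b ac<ab (inArc-to-base⇒dist< a b d (<-trans ac>0 ac<ab) d∈ba)

  interleaved⇒Cross : (a b c d : Fin n) → InArc a b c → InArc b a d → Cross (a , b) (c , d)
  interleaved⇒Cross a b c d c∈ab d∈ba =
    ≢-sym (inArc⇒≢start a b c c∈ab) , ≢-sym (inArc⇒≢end b a d d∈ba) ,
    ≢-sym (inArc⇒≢end a b c c∈ab) , ≢-sym (inArc⇒≢start b a d d∈ba) ,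
    inj₁ (c∈ab , inArc-disjoint b a d d∈ba)

  Cross-swapʳ : {a b c d : Fin n} → Cross (a , b) (c , d) → Cross (a , b) (d , c)
  Cross-swapʳ (a≢c , a≢d , b≢c , b≢d , inj₁ (c∈ , d∉)) = a≢d , a≢c , b≢d , b≢c , inj₂ (d∉ , c∈)
  Cross-swapʳ (a≢c , a≢d , b≢c , b≢d , inj₂ (c∉ , d∈)) = a≢d , a≢c , b≢d , b≢c , inj₁ (d∈ , c∉)

  module _ (T : Tiling n) where

    Adj-sym : {a b : Fin n} → Adj T a b → Adj T b a
    Adj-sym (inj₁ b≡next-a) = inj₂ (inj₁ b≡next-a)
    Adj-sym (inj₂ (inj₁ a≡next-b)) = inj₁ a≡next-b
    Adj-sym (inj₂ (inj₂ (inj₁ ab∈T))) = inj₂ (inj₂ (inj₂ ab∈T))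
    Adj-sym (inj₂ (inj₂ (inj₂ ba∈T))) = inj₂ (inj₂ (inj₁ ba∈T))

    sides-noninterleaving : {a b c d : Fin n} → Adj T a b → Adj T c d →
                            InArc a b c → InArc b a d → ⊥
    sides-noninterleaving {a} {c = c} (inj₁ refl) _ c∈ab _ = ¬inArc-next a c c∈ab
    sides-noninterleaving {b = b} {d = d} (inj₂ (inj₁ refl)) _ _ d∈ba = ¬inArc-next b d d∈ba
    sides-noninterleaving {a} {b} {c} (inj₂ (inj₂ _)) (inj₁ refl) c∈ab d∈ba =
      ¬inArc-next c b (interleaved-rotate a b c (next c) c∈ab d∈ba)
    sides-noninterleaving {a} {b} {d = d} (inj₂ (inj₂ _)) (inj₂ (inj₁ refl)) c∈ab d∈ba =
      ¬inArc-next d a (interleaved-rotate b a d (next d) d∈ba c∈ab)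
    sides-noninterleaving {a} {b} {c} {d} (inj₂ (inj₂ ab∈T∪ba∈T)) (inj₂ (inj₂ cd∈T∪dc∈T)) c∈ab d∈ba =
      crossing ab∈T∪ba∈T cd∈T∪dc∈T
      where
      ab×cd : Cross (a , b) (c , d)
      ab×cd = interleaved⇒Cross a b c d c∈ab d∈ba
      ba×dc : Cross (b , a) (d , c)
      ba×dc = interleaved⇒Cross b a d c d∈ba c∈ab
      crossing : (a , b) ∈ diags T ⊎ (b , a) ∈ diags T → (c , d) ∈ diags T ⊎ (d , c) ∈ diags T → ⊥
      crossing (inj₁ ab∈T) (inj₁ cd∈T) = noCross T _ _ ab∈T cd∈T ab×cd
      crossing (inj₁ ab∈T) (inj₂ dc∈T) = noCross T _ _ ab∈T dc∈T (Cross-swapʳ ab×cd)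
      crossing (inj₂ ba∈T) (inj₁ cd∈T) = noCross T _ _ ba∈T cd∈T (Cross-swapʳ ba×dc)
      crossing (inj₂ ba∈T) (inj₂ dc∈T) = noCross T _ _ ba∈T dc∈T ba×dc

    reach-inArc : {a b y : Fin n} → 0 < dist a b → Adj T a b → Reach T a b y → InArc b a y
    reach-inArc _ _ (stop (_ , p∈ba , _) _ _) = p∈ba
    reach-inArc {a} {b} {y} ab>0 ab-side
                (cont {p = p} {p' = p'} (_ , p∈ba , _) (pp'-side , p'∈ap , _) _ reach) =
      dist<⇒inArc-to-base a b y ab>0 (≤-<-trans ab≤ap' ap'<ay)
      where
      y∈p'p : InArc p' p y
      y∈p'p = reach-inArc (dist-pos p p' (inArc⇒≢end a p p' p'∈ap)) pp'-side reach
      ap'<ay : dist a p' < dist a y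
      ap'<ay = proj₁ (inArc⇒between a p' p y (<⇒≤ (proj₂ p'∈ap)) y∈p'p)
      ab≤ap' : dist a b ≤ dist a p'
      ab≤ap' = ≮⇒≥ λ ap'<ab →
        sides-noninterleaving ab-side (Adj-sym pp'-side) (proj₁ p'∈ap , ap'<ab) p∈ba

    scott-inArc : 2 ≤ n → {x y : Fin n} → Scott T x y → InArc (next x) x y
    scott-inArc 2≤n {x} = reach-inArc x-next>0 (inj₁ refl)
      where
      x-next>0 : 0 < dist x (next x)
      x-next>0 = subst (0 <_) (sym (trans (dist-next x) (m<n⇒m%n≡m 2≤n))) (s≤s z≤n)

mainTheorem8 : (n : ℕ) .{{_ : NonZero n}} → 3 ≤ n → (T : Tiling n) →
    ∀ (x y : Fin n) → Scott T x y → (y ≢ x) × (y ≢ next x)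
mainTheorem8 n 3≤n T x y strand = inArc⇒≢end (next x) x y y∈ , inArc⇒≢start (next x) x y y∈
  where
  y∈ : InArc (next x) x y
  y∈ = scott-inArc T (<⇒≤ 3≤n) strand
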